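{- Let $m$ be a measure on a pseudo-BCK algebra $A$. Then $A/\mathrm{Ker}_0(m)$ is a pseudo-BCK algebra, the mapping $\hat m:A/\mathrm{Ker}_0(m)\to[0,+\infty)$ defined by $\hat m(x/\mathrm{Ker}_0(m)):=m(x)$ is a well-defined measure on $A/\mathrm{Ker}_0(m)$, and $A/\mathrm{Ker}_0(m)$ is $\vee$-commutative (i.e., both $\vee_1$-commutative and $\vee_2$-commutative).
   Context: A pseudo-BCK algebra is a structure $(A,\le,\rightarrow,\rightsquigarrow,1)$ with $\le$ a binary relation, $\rightarrow,\rightsquigarrow$ binary operations and $1\in A$, such that for all $x,y,z\in A$: $x\rightarrow y\le (y\rightarrow z)\rightsquigarrow(x\rightarrow z)$ and $x\rightsquigarrow y\le (y\rightsquigarrow z)\rightarrow(x\rightsquigarrow z)$; $x\le (x\rightarrow y)\rightsquigarrow y$ and $x\le (x\rightsquigarrow y)\rightarrow y$; $x\le x$; $x\le 1$; antisymmetry of $\le$; $x\le y$ iff $x\rightarrow y=1$ iff $x\rightsquigarrow y=1$. Set $x\vee_1 y=(x\rightarrow y)\rightsquigarrow y$, $x\vee_2 y=(x\rightsquigarrow y)\rightarrow y$; $A$ is $\vee_i$-commutative if $x\vee_i y=y\vee_i x$ for all $x,y$. A measure on $A$ is a map $m:A\to[0,\infty)$ with $m(x\rightarrow y)=m(x\rightsquigarrow y)=m(y)-m(x)$ whenever $y\le x$; $\mathrm{Ker}_0(m)=\{x\in A: m(x)=0\}$ (a normal filter). A filter is a set $F\ni 1$ with $a,a\rightarrow b\in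 F\Rightarrow b\in F$; normal if $a\rightarrow b\in F\iff a\rightsquigarrow b\in F$; for a normal filter $F$, $A/F$ is the quotient by the congruence $a\Theta_F b\iff a\rightarrow b, b\rightarrow a\in F$. -}

module Defs where

open import Level using (0ℓ)
open import Data.Product using (Σ; ∃; _×_; _,_)
open import Relation.Nullary using (¬_)
open import Relation.Binary.Core using (Rel)
open import Relation.Binary.Structures using (IsEquivalence; IsTotalOrder)
open import Relation.Binary.PropositionalEquality using (_≡_)
open import Algebra.Structures using (IsCommutativeRing)

-- The real numbers, axiomatised as a Dedekind-complete ordered field.
-- (agda-stdlib has no reals; the theorem is quantified over every
-- model of these axioms.)

record RealField : Set₁ where
  infixl 6 _+_ _-_
  infixl 7 _*_
  infix 4 _≤_
  field
    ℝ   : Set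
    _+_ _*_ : ℝ → ℝ → ℝ
    -_  : ℝ → ℝ
    0# 1# : ℝ
    _≤_ : ℝ → ℝ → Set
    isCommutativeRing : IsCommutativeRing _≡_ _+_ _*_ -_ 0# 1#
    0≢1        : ¬ (0# ≡ 1#)
    inverse    : ∀ x → ¬ (x ≡ 0#) → ∃ λ y → x * y ≡ 1#
    isTotalOrder : IsTotalOrder _≡_ _≤_
    +-mono-≤   : ∀ x y z → x ≤ y → x + z ≤ y + z
    *-nonneg   : ∀ x y → 0# ≤ x → 0# ≤ y → 0# ≤ x * y
    complete   : (P : ℝ → Set) → (∃ λ x → P x) →
                 (∃ λ b → ∀ x → P x → x ≤ b) →
                 ∃ λ s → (∀ x → P x → x ≤ s) ×
                         (∀ b → (∀ x → P x → x ≤ b) → s ≤ b)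

  _-_ : ℝ → ℝ → ℝ
  x - y = x + (- y)

-- Pseudo-BCK algebras, stated over an arbitrary equality _≈_ so that
-- quotients can be expressed as setoids (same carrier, coarser equality).
-- For an honest algebra take _≈_ = _≡_ (congruence fields are then trivial).

record IsPseudoBCK {A : Set} (_≈_ : Rel A 0ℓ) (_≤_ : Rel A 0ℓ)
                   (_⇒_ _⇝_ : A → A → A) (𝟙 : A) : Set where
  field
    isEquivalence : IsEquivalence _≈_
    ⇒-cong : ∀ {x x′ y y′} → x ≈ x′ → y ≈ y′ → (x ⇒ y) ≈ (x′ ⇒ y′)
    ⇝-cong : ∀ {x x′ y y′} → x ≈ x′ → y ≈ y′ → (x ⇝ y) ≈ (x′ ⇝ y′)
    ≤-resp : ∀ {x x′ y y′} → x ≈ x′ → y ≈ y′ → x ≤ y → x′ ≤ y′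
    ax1⇒  : ∀ x y z → (x ⇒ y) ≤ ((y ⇒ z) ⇝ (x ⇒ z))
    ax1⇝  : ∀ x y z → (x ⇝ y) ≤ ((y ⇝ z) ⇒ (x ⇝ z))
    ax2⇒  : ∀ x y → x ≤ ((x ⇒ y) ⇝ y)
    ax2⇝  : ∀ x y → x ≤ ((x ⇝ y) ⇒ y)
    refl≤ : ∀ x → x ≤ x
    top   : ∀ x → x ≤ 𝟙
    antisym : ∀ x y → x ≤ y → y ≤ x → x ≈ y
    ≤→⇒   : ∀ x y → x ≤ y → (x ⇒ y) ≈ 𝟙
    ⇒→≤   : ∀ x y → (x ⇒ y) ≈ 𝟙 → x ≤ y
    ≤→⇝   : ∀ x y → x ≤ y → (x ⇝ y) ≈ 𝟙
    ⇝→≤   : ∀ x y → (x ⇝ y) ≈ 𝟙 → x ≤ y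

module _ {A : Set} (_⇒_ _⇝_ : A → A → A) where
  _∨₁_ : A → A → A
  x ∨₁ y = (x ⇒ y) ⇝ y

  _∨₂_ : A → A → A
  x ∨₂ y = (x ⇝ y) ⇒ y

module _ (R : RealField) where
  open RealField R

  record IsMeasure {A : Set} (_≤ᴬ_ : Rel A 0ℓ) (_⇒_ _⇝_ : A → A → A)
                   (m : A → ℝ) : Set where
    field
      nonneg : ∀ x → 0# ≤ m x
      meas⇒  : ∀ x y → y ≤ᴬ x → m (x ⇒ y) ≡ m y - m x
      meas⇝  : ∀ x y → y ≤ᴬ x → m (x ⇝ y) ≡ m y - m x

  Ker₀ : {A : Set} → (A → ℝ) → A → Set
  Ker₀ m x = m x ≡ 0#

-- Quotient by a filter F (a predicate on A): the congruence Θ_F and the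
-- induced order  a/F ≤ b/F  iff  a/F → b/F = 1/F  (i.e. (a→b) Θ_F 1).

module _ {A : Set} (_⇒_ : A → A → A) (𝟙 : A) (F : A → Set) where
  Θ : A → A → Set
  Θ a b = F (a ⇒ b) × F (b ⇒ a)

  _≤Θ_ : A → A → Set
  a ≤Θ b = Θ (a ⇒ b) 𝟙

module Submission where

open import Defs
open import Data.Product using (_×_; _,_; proj₂)
open import Relation.Binary.PropositionalEquality
  using (_≡_; sym; trans; cong; cong₂; subst; subst₂; module ≡-Reasoning)
open import Relation.Binary.Structures using (IsTotalOrder)
open import Algebra.Structures using (IsCommutativeRing)

module OrderedFieldArithmetic (R : RealField) where
  open RealField R
  open IsCommutativeRing isCommutativeRing
    using (+-assoc; +-comm; +-identityˡ; +-identityʳ; -‿inverseˡ; -‿inverseʳ)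
  open ≡-Reasoning

  sub-add : ∀ p q → (p - q) + q ≡ p
  sub-add p q = begin
    (p - q) + q    ≡⟨ +-assoc p (- q) q ⟩
    p + (- q + q)  ≡⟨ cong (p +_) (-‿inverseˡ q) ⟩
    p + 0#         ≡⟨ +-identityʳ p ⟩
    p              ∎

  add-sub : ∀ p q → (p + q) - q ≡ p
  add-sub p q = begin
    (p + q) - q    ≡⟨ +-assoc p q (- q) ⟩
    p + (q - q)    ≡⟨ cong (p +_) (-‿inverseʳ q) ⟩
    p + 0#         ≡⟨ +-identityʳ p ⟩
    p              ∎

  sub-zero : ∀ p → p - 0# ≡ p
  sub-zero p = trans (cong (λ t → t - 0#) (sym (+-identityʳ p))) (add-sub p 0#)

  ≤+⇒-≤ : ∀ c p d → c ≤ p + d → c - d ≤ p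
  ≤+⇒-≤ c p d h = subst (c - d ≤_) (add-sub p d) (+-mono-≤ c (p + d) (- d) h)

  +-cancelʳ-≤ : ∀ x y z → x + z ≤ y + z → x ≤ y
  +-cancelʳ-≤ x y z h = subst₂ _≤_ (add-sub x z) (add-sub y z) (+-mono-≤ _ _ (- z) h)

  diff-nonneg⇒≤ : ∀ a b → 0# ≤ a - b → b ≤ a
  diff-nonneg⇒≤ a b h = subst₂ _≤_ (+-identityˡ b) (sub-add a b) (+-mono-≤ 0# (a - b) b h)

  ≤⇒≤+diff : ∀ a b c → b ≤ a → c ≤ a + (c - b)
  ≤⇒≤+diff a b c h = subst (_≤ a + (c - b)) b+[c-b]≡c (+-mono-≤ b a (c - b) h)
    where
    b+[c-b]≡c : b + (c - b) ≡ c
    b+[c-b]≡c = trans (+-comm b (c - b)) (sub-add c b)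

  sub-reflects-≤ : ∀ a u v → a - v ≤ a - u → u ≤ v
  sub-reflects-≤ a u v h =
    +-cancelʳ-≤ u v a (subst₂ _≤_ (+-comm a u) (+-comm a v) (subst (_≤ a + v) lhs≡a+u shifted))
    where
    shifted : ((a - v) + u) + v ≤ a + v
    shifted = +-mono-≤ _ _ v (subst ((a - v) + u ≤_) (sub-add a u) (+-mono-≤ _ _ u h))
    lhs≡a+u : ((a - v) + u) + v ≡ a + u
    lhs≡a+u = begin
      ((a - v) + u) + v  ≡⟨ +-assoc (a - v) u v ⟩
      (a - v) + (u + v)  ≡⟨ cong ((a - v) +_) (+-comm u v) ⟩
      (a - v) + (v + u)  ≡⟨ sym (+-assoc (a - v) v u) ⟩
      ((a - v) + v) + u  ≡⟨ cong (_+ u) (sub-add a v) ⟩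
      a + u              ∎

-- The axioms of pseudo-BCK algebras and measures are symmetric in ⇒ and ⇝;
-- this duality lets every one-sided lemma be reused for the other arrow.
swapBCK : {A : Set} {_≼_ : A → A → Set} {_⇒_ _⇝_ : A → A → A} {𝟙 : A} →
          IsPseudoBCK _≡_ _≼_ _⇒_ _⇝_ 𝟙 → IsPseudoBCK _≡_ _≼_ _⇝_ _⇒_ 𝟙
swapBCK P = record
  { isEquivalence = isEquivalence ; ⇒-cong = ⇝-cong ; ⇝-cong = ⇒-cong ; ≤-resp = ≤-resp
  ; ax1⇒ = ax1⇝ ; ax1⇝ = ax1⇒ ; ax2⇒ = ax2⇝ ; ax2⇝ = ax2⇒ ; refl≤ = refl≤ ; top = top
  ; antisym = antisym ; ≤→⇒ = ≤→⇝ ; ⇒→≤ = ⇝→≤ ; ≤→⇝ = ≤→⇒ ; ⇝→≤ = ⇒→≤ }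
  where open IsPseudoBCK P

swapMeasure : (R : RealField) {A : Set} {_≼_ : A → A → Set} {_⇒_ _⇝_ : A → A → A}
              {m : A → RealField.ℝ R} →
              IsMeasure R _≼_ _⇒_ _⇝_ m → IsMeasure R _≼_ _⇝_ _⇒_ m
swapMeasure R M = record { nonneg = nonneg ; meas⇒ = meas⇝ ; meas⇝ = meas⇒ }
  where open IsMeasure M

module PseudoBCKFacts {A : Set} (_≼_ : A → A → Set) (_⇒_ _⇝_ : A → A → A) (𝟙 : A)
                      (P : IsPseudoBCK _≡_ _≼_ _⇒_ _⇝_ 𝟙) where
  open IsPseudoBCK P

  _∨_ : A → A → A
  x ∨ y = _∨₁_ _⇒_ _⇝_ x y

  top-unique : ∀ a → 𝟙 ≼ a → a ≡ 𝟙
  top-unique a h = antisym a 𝟙 (top a) h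

  𝟙⇒-identity : ∀ x → 𝟙 ⇒ x ≡ x
  𝟙⇒-identity x = antisym _ _ (⇝→≤ _ _ (top-unique _ (ax2⇒ 𝟙 x)))
    (subst (λ t → x ≼ (t ⇒ x)) (≤→⇝ x x (refl≤ x)) (ax2⇝ x x))

  𝟙⇝-identity : ∀ x → 𝟙 ⇝ x ≡ x
  𝟙⇝-identity x = antisym _ _ (⇒→≤ _ _ (top-unique _ (ax2⇝ 𝟙 x)))
    (subst (λ t → x ≼ (t ⇝ x)) (≤→⇒ x x (refl≤ x)) (ax2⇒ x x))

  ≼-trans : ∀ {x y z} → x ≼ y → y ≼ z → x ≼ z
  ≼-trans {x} {y} {z} x≼y y≼z =
    ⇒→≤ x z (top-unique _ (subst (𝟙 ≼_) (𝟙⇝-identity (x ⇒ z)) 𝟙≼𝟙⇝[x⇒z]))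
    where
    𝟙≼𝟙⇝[x⇒z] : 𝟙 ≼ (𝟙 ⇝ (x ⇒ z))
    𝟙≼𝟙⇝[x⇒z] = subst₂ (λ a b → a ≼ (b ⇝ (x ⇒ z))) (≤→⇒ x y x≼y) (≤→⇒ y z y≼z) (ax1⇒ x y z)

  ⇒-antitone : ∀ {x y} z → x ≼ y → (y ⇒ z) ≼ (x ⇒ z)
  ⇒-antitone {x} {y} z h =
    ⇝→≤ _ _ (top-unique _ (subst (_≼ ((y ⇒ z) ⇝ (x ⇒ z))) (≤→⇒ x y h) (ax1⇒ x y z)))

  ⇝-antitone : ∀ {x y} z → x ≼ y → (y ⇝ z) ≼ (x ⇝ z)
  ⇝-antitone {x} {y} z h =
    ⇒→≤ _ _ (top-unique _ (subst (_≼ ((y ⇝ z) ⇒ (x ⇝ z))) (≤→⇝ x y h) (ax1⇝ x y z)))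

  exchange⇝⇒ : ∀ {x y z} → x ≼ (y ⇝ z) → y ≼ (x ⇒ z)
  exchange⇝⇒ {x} {y} {z} h = ≼-trans (ax2⇝ y z) (⇒-antitone z h)

  exchange⇒⇝ : ∀ {x y z} → x ≼ (y ⇒ z) → y ≼ (x ⇝ z)
  exchange⇒⇝ {x} {y} {z} h = ≼-trans (ax2⇒ y z) (⇝-antitone z h)

  below-⇒ : ∀ x y → y ≼ (x ⇒ y)
  below-⇒ x y = subst (_≼ (x ⇒ y)) (𝟙⇒-identity y) (⇒-antitone y (top x))

  below-⇝ : ∀ x y → y ≼ (x ⇝ y)
  below-⇝ x y = subst (_≼ (x ⇝ y)) (𝟙⇝-identity y) (⇝-antitone y (top x))

  ∨-⇒-absorb : ∀ x y → (x ∨ y) ⇒ y ≡ x ⇒ y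
  ∨-⇒-absorb x y = antisym _ _ (⇒-antitone y (ax2⇒ x y)) (ax2⇝ (x ⇒ y) y)

  ⇝⇒-exchange : ∀ u a b → (a ⇝ (u ⇒ b)) ≼ (u ⇒ (a ⇝ b))
  ⇝⇒-exchange u a b = exchange⇝⇒ (≼-trans (ax2⇒ u b) (exchange⇒⇝ (ax1⇝ a (u ⇒ b) b)))

  record IsNormalFilter (F : A → Set) : Set where
    field
      contains-𝟙 : F 𝟙
      modus-ponens : ∀ {x y} → F x → F (x ⇒ y) → F y
      normal⇒ : ∀ {x y} → F (x ⇒ y) → F (x ⇝ y)
      normal⇝ : ∀ {x y} → F (x ⇝ y) → F (x ⇒ y)

  module Quotient {F : A → Set} (N : IsNormalFilter F) where
    open IsNormalFilter N

    ≼⇒F : ∀ {a b} → a ≼ b → F (a ⇒ b)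
    ≼⇒F {a} {b} h = subst F (sym (≤→⇒ a b h)) contains-𝟙

    upward-closed : ∀ {x y} → F x → x ≼ y → F y
    upward-closed Fx x≼y = modus-ponens Fx (≼⇒F x≼y)

    F-trans : ∀ {a b c} → F (a ⇒ b) → F (b ⇒ c) → F (a ⇒ c)
    F-trans {a} {b} {c} ab bc = modus-ponens bc (normal⇝ (upward-closed ab (ax1⇒ a b c)))

    F⇒Θ𝟙 : ∀ {c} → F c → Θ _⇒_ 𝟙 F c 𝟙
    F⇒Θ𝟙 {c} h = ≼⇒F (top c) , subst F (sym (𝟙⇒-identity c)) h

    Θ𝟙⇒F : ∀ {c} → Θ _⇒_ 𝟙 F c 𝟙 → F c
    Θ𝟙⇒F {c} h = subst F (𝟙⇒-identity c) (proj₂ h)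

    ⇒-antitone-F : ∀ {x x′} y → F (x′ ⇒ x) → F ((x ⇒ y) ⇒ (x′ ⇒ y))
    ⇒-antitone-F {x} {x′} y h = normal⇝ (upward-closed h (ax1⇒ x′ x y))

    ⇒-monotone-F : ∀ {y y′} z → F (y ⇒ y′) → F ((z ⇒ y) ⇒ (z ⇒ y′))
    ⇒-monotone-F {y} {y′} z h = upward-closed h (exchange⇝⇒ (ax1⇒ z y y′))

    ⇝-antitone-F : ∀ {x x′} y → F (x′ ⇒ x) → F ((x ⇝ y) ⇒ (x′ ⇝ y))
    ⇝-antitone-F {x} {x′} y h = upward-closed (normal⇒ h) (ax1⇝ x′ x y)

    ⇝-monotone-F : ∀ {y y′} z → F (y ⇒ y′) → F ((z ⇝ y) ⇒ (z ⇝ y′))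
    ⇝-monotone-F {y} {y′} z h = normal⇝ (upward-closed (normal⇒ h) (exchange⇒⇝ (ax1⇝ z y y′)))

    quotient-isPseudoBCK : IsPseudoBCK (Θ _⇒_ 𝟙 F) (_≤Θ_ _⇒_ 𝟙 F) _⇒_ _⇝_ 𝟙
    quotient-isPseudoBCK = record
      { isEquivalence = record
          { refl = λ {a} → ≼⇒F (refl≤ a) , ≼⇒F (refl≤ a)
          ; sym = λ (p , q) → q , p
          ; trans = λ (p , q) (p′ , q′) → F-trans p p′ , F-trans q′ q }
      ; ⇒-cong = λ {x} {x′} {y} {y′} (xx′ , x′x) (yy′ , y′y) →
          F-trans (⇒-antitone-F y x′x) (⇒-monotone-F x′ yy′) ,
          F-trans (⇒-antitone-F y′ xx′) (⇒-monotone-F x y′y)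
      ; ⇝-cong = λ {x} {x′} {y} {y′} (xx′ , x′x) (yy′ , y′y) →
          F-trans (⇝-antitone-F y x′x) (⇝-monotone-F x′ yy′) ,
          F-trans (⇝-antitone-F y′ xx′) (⇝-monotone-F x y′y)
      ; ≤-resp = λ (_ , x′x) (yy′ , _) h → F⇒Θ𝟙 (F-trans x′x (F-trans (Θ𝟙⇒F h) yy′))
      ; ax1⇒ = λ x y z → F⇒Θ𝟙 (≼⇒F (ax1⇒ x y z))
      ; ax1⇝ = λ x y z → F⇒Θ𝟙 (≼⇒F (ax1⇝ x y z))
      ; ax2⇒ = λ x y → F⇒Θ𝟙 (≼⇒F (ax2⇒ x y))
      ; ax2⇝ = λ x y → F⇒Θ𝟙 (≼⇒F (ax2⇝ x y))
      ; refl≤ = λ x → F⇒Θ𝟙 (≼⇒F (refl≤ x))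
      ; top = λ x → F⇒Θ𝟙 (≼⇒F (top x))
      ; antisym = λ x y h₁ h₂ → Θ𝟙⇒F h₁ , Θ𝟙⇒F h₂
      ; ≤→⇒ = λ x y h → h
      ; ⇒→≤ = λ x y h → h
      ; ≤→⇝ = λ x y h → F⇒Θ𝟙 (normal⇒ (Θ𝟙⇒F h))
      ; ⇝→≤ = λ x y h → F⇒Θ𝟙 (normal⇝ (Θ𝟙⇒F h))
      }

module MeasureFacts (R : RealField) {A : Set} (_≼_ : A → A → Set) (_⇒_ _⇝_ : A → A → A)
                    (𝟙 : A) (P : IsPseudoBCK _≡_ _≼_ _⇒_ _⇝_ 𝟙)
                    (m : A → RealField.ℝ R) (M : IsMeasure R _≼_ _⇒_ _⇝_ m) where
  open RealField R
  open IsTotalOrder isTotalOrder using () renaming (antisym to ℝ-antisym; trans to ℝ-trans)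
  open IsCommutativeRing isCommutativeRing using (+-identityʳ; -‿inverseʳ)
  open OrderedFieldArithmetic R
  open IsPseudoBCK P using (refl≤; ≤→⇒; ax2⇒; ax2⇝)
  open IsMeasure M
  open PseudoBCKFacts _≼_ _⇒_ _⇝_ 𝟙 P
  open ≡-Reasoning

  Ker : A → Set
  Ker = Ker₀ R m

  m-𝟙 : m 𝟙 ≡ 0#
  m-𝟙 = begin
    m 𝟙          ≡⟨ cong m (≤→⇒ 𝟙 𝟙 (refl≤ 𝟙)) ⟨
    m (𝟙 ⇒ 𝟙)    ≡⟨ meas⇒ 𝟙 𝟙 (refl≤ 𝟙) ⟩
    m 𝟙 - m 𝟙    ≡⟨ -‿inverseʳ (m 𝟙) ⟩
    0#           ∎

  antitone : ∀ {x y} → y ≼ x → m x ≤ m y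
  antitone {x} {y} h = diff-nonneg⇒≤ (m y) (m x) (subst (0# ≤_) (meas⇒ x y h) (nonneg (x ⇒ y)))

  measure-via-join : ∀ x y → m (x ⇒ y) ≡ m y - m (x ∨ y)
  measure-via-join x y = begin
    m (x ⇒ y)          ≡⟨ cong m (∨-⇒-absorb x y) ⟨
    m ((x ∨ y) ⇒ y)    ≡⟨ meas⇒ (x ∨ y) y (below-⇝ (x ⇒ y) y) ⟩
    m y - m (x ∨ y)    ∎

  -- Subadditivity along ⇒, a consequence of x ≼ x ∨ y.
  subadditive : ∀ x y → m y ≤ m x + m (x ⇒ y)
  subadditive x y = subst (λ t → m y ≤ m x + t) (sym (measure-via-join x y))
    (≤⇒≤+diff (m x) (m (x ∨ y)) (m y) (antitone (ax2⇒ x y)))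

  -- Half of m(a ⇒ b) = m(a ⇝ b); the other half is the dual statement.
  ⇒-below-⇝ : ∀ a b → m (a ⇒ b) ≤ m (a ⇝ b)
  ⇒-below-⇝ a b = ℝ-trans (antitone (⇒-antitone b (ax2⇝ a b)))
    (subst (_≤ m (a ⇝ b)) (sym (meas⇒ d b (below-⇒ (a ⇝ b) b)))
      (≤+⇒-≤ (m b) (m (a ⇝ b)) (m d) (subadditive (a ⇝ b) b)))
    where d = (a ⇝ b) ⇒ b

  Ker-upward : ∀ {x y} → Ker x → x ≼ y → Ker y
  Ker-upward {x} {y} kx h = ℝ-antisym (subst (m y ≤_) kx (antitone h)) (nonneg y)

  Ker-mp : ∀ {x y} → Ker x → Ker (x ⇒ y) → Ker y
  Ker-mp {x} {y} kx kxy =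
    ℝ-antisym (subst (m y ≤_) (trans (cong₂ _+_ kx kxy) (+-identityʳ 0#)) (subadditive x y)) (nonneg y)

  Ker⇒-≤ : ∀ {a b} → Ker (a ⇒ b) → m b ≤ m a
  Ker⇒-≤ {a} {b} k = subst (m b ≤_) (trans (cong (m a +_) k) (+-identityʳ (m a))) (subadditive a b)

  -- m(x ∨ y) ≤ m(y ∨ x): since y ≼ x ∨ y, m(y ⇒ x) ≤ m((x ∨ y) ⇒ x), i.e.
  -- m x − m(y ∨ x) ≤ m x − m(x ∨ y).
  join-measure-≤ : ∀ x y → m (x ∨ y) ≤ m (y ∨ x)
  join-measure-≤ x y = sub-reflects-≤ (m x) (m (x ∨ y)) (m (y ∨ x))
    (subst₂ _≤_ (measure-via-join y x) (meas⇒ (x ∨ y) x (ax2⇒ x y))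
      (antitone (⇒-antitone x (below-⇝ (x ⇒ y) y))))

  join-measure-comm : ∀ x y → m (x ∨ y) ≡ m (y ∨ x)
  join-measure-comm x y = ℝ-antisym (join-measure-≤ x y) (join-measure-≤ y x)

  join-comm-Ker : ∀ x y → Ker ((x ∨ y) ⇒ (y ∨ x))
  join-comm-Ker x y = Ker-upward kQ (⇝⇒-exchange (x ∨ y) (y ⇒ x) x)
    where
    same : m ((x ∨ y) ⇒ x) ≡ m (y ⇒ x)
    same = begin
      m ((x ∨ y) ⇒ x)   ≡⟨ meas⇒ (x ∨ y) x (ax2⇒ x y) ⟩
      m x - m (x ∨ y)   ≡⟨ cong (λ t → m x - t) (join-measure-comm x y) ⟩
      m x - m (y ∨ x)   ≡⟨ measure-via-join y x ⟨
      m (y ⇒ x)         ∎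
    kQ : Ker ((y ⇒ x) ⇝ ((x ∨ y) ⇒ x))
    kQ = begin
      m ((y ⇒ x) ⇝ ((x ∨ y) ⇒ x))      ≡⟨ meas⇝ (y ⇒ x) _ (⇒-antitone x (below-⇝ (x ⇒ y) y)) ⟩
      m ((x ∨ y) ⇒ x) - m (y ⇒ x)      ≡⟨ cong (_- m (y ⇒ x)) same ⟩
      m (y ⇒ x) - m (y ⇒ x)            ≡⟨ -‿inverseʳ (m (y ⇒ x)) ⟩
      0#                               ∎

  join-absorbs : ∀ {x y} → Ker (y ⇒ x) → m (y ∨ x) ≡ m x
  join-absorbs {x} {y} k = begin
    m ((y ⇒ x) ⇝ x)     ≡⟨ meas⇝ (y ⇒ x) x (below-⇒ y x) ⟩
    m x - m (y ⇒ x)     ≡⟨ cong (λ t → m x - t) k ⟩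
    m x - 0#            ≡⟨ sub-zero (m x) ⟩
    m x                 ∎

  meas⇒-mod-Ker : ∀ x y → Ker (y ⇒ x) → m (x ⇒ y) ≡ m y - m x
  meas⇒-mod-Ker x y k = begin
    m (x ⇒ y)          ≡⟨ measure-via-join x y ⟩
    m y - m (x ∨ y)    ≡⟨ cong (λ t → m y - t) (join-measure-comm x y) ⟩
    m y - m (y ∨ x)    ≡⟨ cong (λ t → m y - t) (join-absorbs k) ⟩
    m y - m x          ∎

module MeasureTheory (R : RealField) {A : Set} (_≼_ : A → A → Set) (_⇒_ _⇝_ : A → A → A)
                     (𝟙 : A) (P : IsPseudoBCK _≡_ _≼_ _⇒_ _⇝_ 𝟙)
                     (m : A → RealField.ℝ R) (M : IsMeasure R _≼_ _⇒_ _⇝_ m) where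
  open RealField R using (_-_)
  open IsTotalOrder (RealField.isTotalOrder R) using () renaming (antisym to ℝ-antisym)
  open PseudoBCKFacts _≼_ _⇒_ _⇝_ 𝟙 P using (IsNormalFilter; module Quotient)
  module Left  = MeasureFacts R _≼_ _⇒_ _⇝_ 𝟙 P m M
  module Right = MeasureFacts R _≼_ _⇝_ _⇒_ 𝟙 (swapBCK P) m (swapMeasure R M)
  open Left using (Ker)

  ⇒-⇝-same-measure : ∀ a b → m (a ⇒ b) ≡ m (a ⇝ b)
  ⇒-⇝-same-measure a b = ℝ-antisym (Left.⇒-below-⇝ a b) (Right.⇒-below-⇝ a b)

  Ker-isNormalFilter : IsNormalFilter Ker
  Ker-isNormalFilter = record
    { contains-𝟙 = Left.m-𝟙
    ; modus-ponens = Left.Ker-mp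
    ; normal⇒ = λ {a} {b} k → trans (sym (⇒-⇝-same-measure a b)) k
    ; normal⇝ = λ {a} {b} k → trans (⇒-⇝-same-measure a b) k
    }

  open Quotient Ker-isNormalFilter using (quotient-isPseudoBCK) public
  open Quotient Ker-isNormalFilter using (Θ𝟙⇒F)
  open IsNormalFilter Ker-isNormalFilter using (normal⇝)

  -- m̂(a/Ker) := m(a) is well defined.
  measure-respects-Θ : ∀ a b → Θ _⇒_ 𝟙 Ker a b → m a ≡ m b
  measure-respects-Θ a b (ab , ba) = ℝ-antisym (Left.Ker⇒-≤ ba) (Left.Ker⇒-≤ ab)

  quotient-isMeasure : IsMeasure R (_≤Θ_ _⇒_ 𝟙 Ker) _⇒_ _⇝_ m
  quotient-isMeasure = record
    { nonneg = IsMeasure.nonneg M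
    ; meas⇒ = meas⇒′
    ; meas⇝ = λ x y h → trans (sym (⇒-⇝-same-measure x y)) (meas⇒′ x y h)
    }
    where
    meas⇒′ : ∀ x y → _≤Θ_ _⇒_ 𝟙 Ker y x → m (x ⇒ y) ≡ m y - m x
    meas⇒′ x y h = Left.meas⇒-mod-Ker x y (Θ𝟙⇒F h)

  ∨₁-comm-mod-Ker : ∀ x y → Θ _⇒_ 𝟙 Ker (_∨₁_ _⇒_ _⇝_ x y) (_∨₁_ _⇒_ _⇝_ y x)
  ∨₁-comm-mod-Ker x y = Left.join-comm-Ker x y , Left.join-comm-Ker y x

  ∨₂-comm-mod-Ker : ∀ x y → Θ _⇒_ 𝟙 Ker (_∨₂_ _⇒_ _⇝_ x y) (_∨₂_ _⇒_ _⇝_ y x)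
  ∨₂-comm-mod-Ker x y = normal⇝ (Right.join-comm-Ker x y) , normal⇝ (Right.join-comm-Ker y x)

theorem4p8 : (R : RealField) → {A : Set} → (_≤_ : A → A → Set) → (_⇒_ _⇝_ : A → A → A) → (𝟙 : A) →
    IsPseudoBCK _≡_ _≤_ _⇒_ _⇝_ 𝟙 →
    (m : A → RealField.ℝ R) → IsMeasure R _≤_ _⇒_ _⇝_ m →
    IsPseudoBCK (Θ _⇒_ 𝟙 (Ker₀ R m)) (_≤Θ_ _⇒_ 𝟙 (Ker₀ R m)) _⇒_ _⇝_ 𝟙
    × (∀ a b → Θ _⇒_ 𝟙 (Ker₀ R m) a b → m a ≡ m b)
    × IsMeasure R (_≤Θ_ _⇒_ 𝟙 (Ker₀ R m)) _⇒_ _⇝_ m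
    × (∀ x y → Θ _⇒_ 𝟙 (Ker₀ R m) (_∨₁_ _⇒_ _⇝_ x y) (_∨₁_ _⇒_ _⇝_ y x))
    × (∀ x y → Θ _⇒_ 𝟙 (Ker₀ R m) (_∨₂_ _⇒_ _⇝_ x y) (_∨₂_ _⇒_ _⇝_ y x))
theorem4p8 R _≼_ _⇒_ _⇝_ 𝟙 P m M =
  quotient-isPseudoBCK , measure-respects-Θ , quotient-isMeasure , ∨₁-comm-mod-Ker , ∨₂-comm-mod-Ker
  where open MeasureTheory R _≼_ _⇒_ _⇝_ 𝟙 P m M
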